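{- For integers $0\le k\le m\le n$, there is a bijection between the set of free Schröder paths of length $2n$ with $m$ flaws in $k$ flaw blocks and the set of leaf-colored doubly rooted plane trees with $n$ edges, stem size $k$ and $m$ prefix edges.
   Context: A free Schröder path of length $2n$ is a lattice path from $(0,0)$ to $(2n,0)$ with steps $U=(1,1)$, $H=(2,0)$, $D=(1,-1)$. It has $m$ flaws if the total number of $U$ steps and $H$ steps lying below the $x$-axis (a $U$ step from height $-j$ to $-j+1$, or an $H$ step at height $-j$, with $j\ge1$) equals $m$. A flaw block is a maximal segment that starts and ends on the $x$-axis and is otherwise strictly below it (a negative elevated Schröder path); their number equals the number of $D$ steps from height $0$ to $-1$. A plane tree is a rooted tree with ordered children; a leaf is a non-root vertex with no children. A leaf-colored doubly rooted plane tree is a plane tree with a distinguished vertex $w$ in which every leaf other than $w$ is colored red or blue. The stem is the path from the root to $w$, and the stem size is its number of edges. Label vertices $0,\dots,n$ in right-to-left preorder (root first, then the subtrees of the root recursively from rightmost to leftmost); an edge is a prefix edge if it is on the stem or to the right of the stem, equivalently if its lower endpoint has label at most the label of $w$. -}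

module Defs where

open import Data.Nat using (ℕ; zero; suc; _+_; _*_; _∸_; _≤ᵇ_; _≡ᵇ_)
open import Data.Integer as ℤ using (ℤ; +_; -[1+_])
open import Data.Bool using (Bool; true; false; _∧_; _∨_; not; if_then_else_)
open import Data.List using (List; []; _∷_; length; _++_)
open import Data.Product using (Σ; _×_; _,_)
open import Relation.Binary.PropositionalEquality using (_≡_)

data Step : Set where
  U H D : Step   -- U = (1,1), H = (2,0), D = (1,-1)

len : List Step → ℕ
len []       = 0
len (U ∷ s)  = 1 + len s
len (H ∷ s)  = 2 + len s
len (D ∷ s)  = 1 + len s

negative : ℤ → Bool
negative (+ _)     = false
negative -[1+ _ ]  = true

isZero : ℤ → Bool
isZero (+ zero) = true
isZero _        = false

endHeight : ℤ → List Step → ℤ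
endHeight h []      = h
endHeight h (U ∷ s) = endHeight (h ℤ.+ ℤ.1ℤ) s
endHeight h (H ∷ s) = endHeight h s
endHeight h (D ∷ s) = endHeight (h ℤ.- ℤ.1ℤ) s

b2n : Bool → ℕ
b2n true  = 1
b2n false = 0

flawsFrom : ℤ → List Step → ℕ
flawsFrom h []      = 0
flawsFrom h (U ∷ s) = b2n (negative h) + flawsFrom (h ℤ.+ ℤ.1ℤ) s
flawsFrom h (H ∷ s) = b2n (negative h) + flawsFrom h s
flawsFrom h (D ∷ s) = flawsFrom (h ℤ.- ℤ.1ℤ) s

-- flaw blocks: number of D steps from height 0 to height -1
flawBlocksFrom : ℤ → List Step → ℕ
flawBlocksFrom h []      = 0
flawBlocksFrom h (U ∷ s) = flawBlocksFrom (h ℤ.+ ℤ.1ℤ) s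
flawBlocksFrom h (H ∷ s) = flawBlocksFrom h s
flawBlocksFrom h (D ∷ s) = b2n (isZero h) + flawBlocksFrom (h ℤ.- ℤ.1ℤ) s

FreeSchroder : (n m k : ℕ) → Set
FreeSchroder n m k =
  Σ (List Step) λ p →
    (len p ≡ 2 * n) × (endHeight (+ 0) p ≡ + 0) ×
    (flawsFrom (+ 0) p ≡ m) × (flawBlocksFrom (+ 0) p ≡ k)

-- vertex decoration: the distinguished vertex w, a red leaf, a blue leaf,
-- or an ordinary (undecorated) vertex
data Mark : Set where
  plain distinguished red blue : Mark

data MTree : Set where
  node : Mark → List MTree → MTree

record VInfo : Set where
  constructor vinfo
  field
    mark     : Mark
    depth    : ℕ
    nchild   : ℕ

mutual
  rlPreorder : ℕ → MTree → List VInfo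
  rlPreorder d (node m ts) = vinfo m d (length ts) ∷ rlForest (suc d) ts

  rlForest : ℕ → List MTree → List VInfo
  rlForest d []       = []
  rlForest d (t ∷ ts) = rlForest d ts ++ rlPreorder d t

-- the list of vertices, labelled 0,1,2,… by position (right-to-left preorder)
vertices : MTree → List VInfo
vertices = rlPreorder 0

isDist : Mark → Bool
isDist distinguished = true
isDist _             = false

isColor : Mark → Bool
isColor red  = true
isColor blue = true
isColor _    = false

countDist : List VInfo → ℕ
countDist []       = 0
countDist (v ∷ vs) = b2n (isDist (VInfo.mark v)) + countDist vs

-- a vertex is colored (red/blue) iff it is a leaf (non-root, no children)
-- other than w; the flag says whether the vertex is the root
colorOK : Bool → VInfo → Bool
colorOK isRoot (vinfo m d c) =
  let leafNotW = not isRoot ∧ (c ≡ᵇ 0) ∧ not (isDist m)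
  in if leafNotW then isColor m else not (isColor m)

allColorOK : Bool → List VInfo → Bool
allColorOK r []       = true
allColorOK r (v ∷ vs) = colorOK r v ∧ allColorOK false vs

WellFormed : MTree → Set
WellFormed t = (countDist (vertices t) ≡ 1) × (allColorOK true (vertices t) ≡ true)

edges : MTree → ℕ
edges t = length (vertices t) ∸ 1

labelW : List VInfo → ℕ
labelW []       = 0
labelW (v ∷ vs) = if isDist (VInfo.mark v) then 0 else suc (labelW vs)

-- depth of w = number of edges on the stem (root to w)
depthW : List VInfo → ℕ
depthW []       = 0
depthW (v ∷ vs) = if isDist (VInfo.mark v) then VInfo.depth v else depthW vs

stemSize : MTree → ℕ
stemSize t = depthW (vertices t)

-- prefix edges: edges whose lower endpoint (a non-root vertex, label i ≥ 1)
-- has label i ≤ label of w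
countPrefix : ℕ → ℕ → List VInfo → ℕ
countPrefix lw i []       = 0
countPrefix lw i (v ∷ vs) = b2n (not (i ≡ᵇ 0) ∧ (i ≤ᵇ lw)) + countPrefix lw (suc i) vs

prefixEdges : MTree → ℕ
prefixEdges t = countPrefix (labelW (vertices t)) 0 (vertices t)

LCDRTree : (n k m : ℕ) → Set
LCDRTree n k m =
  Σ MTree λ t →
    WellFormed t × (edges t ≡ n) × (stemSize t ≡ k) × (prefixEdges t ≡ m)

module Submission where

open import Defs
open import Data.Nat using (ℕ; _≤_; zero; suc; _+_; _*_; _∸_; _<_; z≤n; s≤s; _≤ᵇ_; _≡ᵇ_)
import Data.Nat.Properties as ℕ
open import Data.Nat.Tactic.RingSolver using (solve-∀)
open import Data.Integer as ℤ using (ℤ; +_; -[1+_])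
import Data.Integer.Properties as ℤ
open import Data.Bool using (Bool; true; false; _∧_; not; T)
import Data.Bool.Properties as Bool
open import Data.List using (List; []; _∷_; length; _++_; foldr)
open import Data.List.Properties using (++-identityʳ; ++-assoc; length-++)
open import Data.Product using (Σ; _×_; _,_; proj₁; proj₂)
open import Relation.Binary.PropositionalEquality
open import Relation.Nullary.Irrelevant using (Irrelevant)
open import Relation.Nullary.Negation using (contradiction)
open import Function.Bundles using (_⤖_; _↔_; mk↔ₛ′; Equivalence)
open import Function.Properties.Inverse using (↔⇒⤖; ↔-trans)
open import Axiom.UniquenessOfIdentityProofs using (module Decidable⇒UIP)
open import Algebra.Properties.AbelianGroup ℤ.+-0-abelianGroup using (∙-cancelʳ)
open import Algebra.Bundles using (CommutativeMonoid)
import Algebra.Properties.CommutativeSemigroup as CommutativeSemigroupProperties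
open ≡-Reasoning

-- A free Schröder path returning to the axis factors uniquely as
-- P₀ D R₁ U P₁ D R₂ U P₂ ⋯ D Rₖ U Pₖ, where the Pᵢ are Schröder paths and each Rᵢ is a
-- Schröder path reflected below the axis; so k is the number of flaw blocks, the flaws
-- number k + Σ |Rᵢ| and the semilength is k + Σ |Rᵢ| + Σ |Pᵢ|.  A Schröder path is a
-- plane forest (H a red leaf, U D a blue leaf, U s D a vertex over the forest of s).
-- Hang these forests along a stem of k edges ending at w: the i-th stem vertex carries
-- the forest of Pᵢ to the left of the stem and that of Rᵢ₊₁ to the right, and w carries
-- the forest of Pₖ.  In right-to-left preorder the vertices up to w are the root, the
-- right-hand forests and the stem, so there are exactly k + Σ |Rᵢ| prefix edges.

module +-Props = CommutativeSemigroupProperties ℕ.+-commutativeSemigroup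
module ∧-Props = CommutativeSemigroupProperties
  (CommutativeMonoid.commutativeSemigroup Bool.∧-commutativeMonoid)

×-irrelevant : {A B : Set} → Irrelevant A → Irrelevant B → Irrelevant (A × B)
×-irrelevant irrA irrB (a , b) (a′ , b′) = cong₂ _,_ (irrA a a′) (irrB b b′)

Σ-≡-irrelevant : {A : Set} {P : A → Set} → (∀ {a} → Irrelevant (P a)) →
  {x y : Σ A P} → proj₁ x ≡ proj₁ y → x ≡ y
Σ-≡-irrelevant irr {a , p} {.a , q} refl = cong (a ,_) (irr p q)

↔-restrict : {A B : Set} {P : A → Set} {Q : B → Set} →
  (∀ {a} → Irrelevant (P a)) → (∀ {b} → Irrelevant (Q b)) →
  (f : A → B) (g : B → A) →
  (∀ {a} → P a → Q (f a)) → (∀ {b} → Q b → P (g b)) →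
  (∀ {a} → P a → g (f a) ≡ a) → (∀ {b} → Q b → f (g b) ≡ b) →
  Σ A P ↔ Σ B Q
↔-restrict irrP irrQ f g fQ gP gf fg = mk↔ₛ′
  (λ (a , pa) → f a , fQ pa)
  (λ (b , qb) → g b , gP qb)
  (λ (b , qb) → Σ-≡-irrelevant irrQ (fg qb))
  (λ (a , pa) → Σ-≡-irrelevant irrP (gf pa))

ℤ-≡-irrelevant : {i j : ℤ} → Irrelevant (i ≡ j)
ℤ-≡-irrelevant = Decidable⇒UIP.≡-irrelevant ℤ._≟_

Bool-≡-irrelevant : {a b : Bool} → Irrelevant (a ≡ b)
Bool-≡-irrelevant = Decidable⇒UIP.≡-irrelevant Bool._≟_

≤ᵇ-true : ∀ {m n} → m ≤ n → (m ≤ᵇ n) ≡ true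
≤ᵇ-true m≤n = Equivalence.to Bool.T-≡ (ℕ.≤⇒≤ᵇ m≤n)

≤ᵇ-false : ∀ {m n} → n < m → (m ≤ᵇ n) ≡ false
≤ᵇ-false {m} {n} n<m with m ≤ᵇ n in eq
... | false = refl
... | true  = contradiction (ℕ.≤ᵇ⇒≤ m n (subst T (sym eq) _)) (ℕ.<⇒≱ n<m)

m+[1+n]≡1⇒m≡0×n≡0 : ∀ a {b} → a + suc b ≡ 1 → (a ≡ 0) × (b ≡ 0)
m+[1+n]≡1⇒m≡0×n≡0 zero    refl = refl , refl
m+[1+n]≡1⇒m≡0×n≡0 (suc a) {b} eq with trans (sym (ℕ.+-suc a b)) (ℕ.suc-injective eq)
... | ()

-- Factorisations of free Schröder paths

data Prime : Set where
  flat : Prime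
  lift : List Prime → Prime

Schroder : Set
Schroder = List Prime

-- A block (R , P) stands for D R̄ U P, where R̄ is R reflected below the axis.
Block : Set
Block = Schroder × Schroder

Factorisation : Set
Factorisation = Schroder × List Block

mutual
  semilength₁ : Prime → ℕ
  semilength₁ flat     = 1
  semilength₁ (lift s) = suc (semilength s)

  semilength : Schroder → ℕ
  semilength []      = 0
  semilength (p ∷ s) = semilength₁ p + semilength s

blocksSize : List Block → ℕ
blocksSize []             = 0
blocksSize ((R , P) ∷ bs) = suc (semilength R + semilength P + blocksSize bs)

blocksFlaws : List Block → ℕ
blocksFlaws []             = 0
blocksFlaws ((R , P) ∷ bs) = suc (semilength R + blocksFlaws bs)

size : Factorisation → ℕ
size (P , bs) = semilength P + blocksSize bs

flaws : Factorisation → ℕ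
flaws (_ , bs) = blocksFlaws bs

blockCount : Factorisation → ℕ
blockCount (_ , bs) = length bs

FactorisationWith : (n m k : ℕ) → Set
FactorisationWith n m k =
  Σ Factorisation λ c → (size c ≡ n) × (flaws c ≡ m) × (blockCount c ≡ k)

data Side : Set where
  above below : Side

rise fall : Side → Step
rise above = U
rise below = D
fall above = D
fall below = U

level : Side → ℕ → ℤ
level above n = + n
level below n = -[1+ n ]

mutual
  draw₁ : Side → Prime → List Step → List Step
  draw₁ σ flat     X = H ∷ X
  draw₁ σ (lift s) X = rise σ ∷ draw σ s (fall σ ∷ X)

  draw : Side → Schroder → List Step → List Step
  draw σ []      X = X
  draw σ (p ∷ s) X = draw₁ σ p (draw σ s X)

drawBlocks : List Block → List Step
drawBlocks []             = []
drawBlocks ((R , P) ∷ bs) = D ∷ draw below R (U ∷ draw above P (drawBlocks bs))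

encode : Factorisation → List Step
encode (P , bs) = draw above P (drawBlocks bs)

endHeight-rise : ∀ σ n X → endHeight (level σ n) (rise σ ∷ X) ≡ endHeight (level σ (suc n)) X
endHeight-rise above n X = cong (λ h → endHeight h X) (cong +_ (ℕ.+-comm n 1))
endHeight-rise below n X = cong (λ h → endHeight h X) (cong (λ i → -[1+ suc i ]) (ℕ.+-identityʳ n))

endHeight-fall : ∀ σ n X → endHeight (level σ (suc n)) (fall σ ∷ X) ≡ endHeight (level σ n) X
endHeight-fall above n X = refl
endHeight-fall below n X = refl

mutual
  endHeight-draw₁ : ∀ σ p n X → endHeight (level σ n) (draw₁ σ p X) ≡ endHeight (level σ n) X
  endHeight-draw₁ σ flat     n X = refl
  endHeight-draw₁ σ (lift s) n X = begin
    endHeight (level σ n) (rise σ ∷ draw σ s (fall σ ∷ X))  ≡⟨ endHeight-rise σ n _ ⟩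
    endHeight (level σ (suc n)) (draw σ s (fall σ ∷ X))     ≡⟨ endHeight-draw σ s (suc n) _ ⟩
    endHeight (level σ (suc n)) (fall σ ∷ X)                ≡⟨ endHeight-fall σ n X ⟩
    endHeight (level σ n) X                                 ∎

  endHeight-draw : ∀ σ s n X → endHeight (level σ n) (draw σ s X) ≡ endHeight (level σ n) X
  endHeight-draw σ []      n X = refl
  endHeight-draw σ (p ∷ s) n X =
    trans (endHeight-draw₁ σ p n (draw σ s X)) (endHeight-draw σ s n X)

flawBlocksFrom-rise : ∀ σ n X →
  flawBlocksFrom (level σ n) (rise σ ∷ X) ≡ flawBlocksFrom (level σ (suc n)) X
flawBlocksFrom-rise above n X = cong (λ h → flawBlocksFrom h X) (cong +_ (ℕ.+-comm n 1))
flawBlocksFrom-rise below n X =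
  cong (λ h → flawBlocksFrom h X) (cong (λ i → -[1+ suc i ]) (ℕ.+-identityʳ n))

flawBlocksFrom-fall : ∀ σ n X →
  flawBlocksFrom (level σ (suc n)) (fall σ ∷ X) ≡ flawBlocksFrom (level σ n) X
flawBlocksFrom-fall above n X = refl
flawBlocksFrom-fall below n X = refl

mutual
  flawBlocksFrom-draw₁ : ∀ σ p n X →
    flawBlocksFrom (level σ n) (draw₁ σ p X) ≡ flawBlocksFrom (level σ n) X
  flawBlocksFrom-draw₁ σ flat     n X = refl
  flawBlocksFrom-draw₁ σ (lift s) n X = begin
    flawBlocksFrom (level σ n) (rise σ ∷ draw σ s (fall σ ∷ X))  ≡⟨ flawBlocksFrom-rise σ n _ ⟩
    flawBlocksFrom (level σ (suc n)) (draw σ s (fall σ ∷ X))     ≡⟨ flawBlocksFrom-draw σ s (suc n) _ ⟩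
    flawBlocksFrom (level σ (suc n)) (fall σ ∷ X)                ≡⟨ flawBlocksFrom-fall σ n X ⟩
    flawBlocksFrom (level σ n) X                                 ∎

  flawBlocksFrom-draw : ∀ σ s n X →
    flawBlocksFrom (level σ n) (draw σ s X) ≡ flawBlocksFrom (level σ n) X
  flawBlocksFrom-draw σ []      n X = refl
  flawBlocksFrom-draw σ (p ∷ s) n X =
    trans (flawBlocksFrom-draw₁ σ p n (draw σ s X)) (flawBlocksFrom-draw σ s n X)

mutual
  flawsFrom-draw₁-above : ∀ p n X → flawsFrom (+ n) (draw₁ above p X) ≡ flawsFrom (+ n) X
  flawsFrom-draw₁-above flat     n X = refl
  flawsFrom-draw₁-above (lift s) n X rewrite ℕ.+-comm n 1 = flawsFrom-draw-above s (suc n) (D ∷ X)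

  flawsFrom-draw-above : ∀ s n X → flawsFrom (+ n) (draw above s X) ≡ flawsFrom (+ n) X
  flawsFrom-draw-above []      n X = refl
  flawsFrom-draw-above (p ∷ s) n X =
    trans (flawsFrom-draw₁-above p n (draw above s X)) (flawsFrom-draw-above s n X)

mutual
  flawsFrom-draw₁-below : ∀ p n X →
    flawsFrom -[1+ n ] (draw₁ below p X) ≡ semilength₁ p + flawsFrom -[1+ n ] X
  flawsFrom-draw₁-below flat     n X = refl
  flawsFrom-draw₁-below (lift s) n X rewrite ℕ.+-identityʳ n =
    trans (flawsFrom-draw-below s (suc n) (U ∷ X)) (ℕ.+-suc (semilength s) _)

  flawsFrom-draw-below : ∀ s n X →
    flawsFrom -[1+ n ] (draw below s X) ≡ semilength s + flawsFrom -[1+ n ] X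
  flawsFrom-draw-below []      n X = refl
  flawsFrom-draw-below (p ∷ s) n X = begin
    flawsFrom -[1+ n ] (draw₁ below p (draw below s X))
      ≡⟨ flawsFrom-draw₁-below p n (draw below s X) ⟩
    semilength₁ p + flawsFrom -[1+ n ] (draw below s X)
      ≡⟨ cong (_+_ (semilength₁ p)) (flawsFrom-draw-below s n X) ⟩
    semilength₁ p + (semilength s + flawsFrom -[1+ n ] X)
      ≡⟨ ℕ.+-assoc (semilength₁ p) (semilength s) _ ⟨
    semilength₁ p + semilength s + flawsFrom -[1+ n ] X
      ∎

len-rise : ∀ σ X → len (rise σ ∷ X) ≡ suc (len X)
len-rise above X = refl
len-rise below X = refl

len-fall : ∀ σ X → len (fall σ ∷ X) ≡ suc (len X)
len-fall above X = refl
len-fall below X = refl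

mutual
  len-draw₁ : ∀ σ p X → len (draw₁ σ p X) ≡ 2 * semilength₁ p + len X
  len-draw₁ σ flat     X = refl
  len-draw₁ σ (lift s) X = begin
    len (rise σ ∷ draw σ s (fall σ ∷ X))      ≡⟨ len-rise σ _ ⟩
    suc (len (draw σ s (fall σ ∷ X)))         ≡⟨ cong suc (len-draw σ s _) ⟩
    suc (2 * semilength s + len (fall σ ∷ X)) ≡⟨ cong (λ l → suc (2 * semilength s + l)) (len-fall σ X) ⟩
    suc (2 * semilength s + suc (len X))      ≡⟨ arith (semilength s) (len X) ⟩
    2 * suc (semilength s) + len X            ∎
    where
    arith : ∀ a b → suc (2 * a + suc b) ≡ 2 * suc a + b
    arith = solve-∀

  len-draw : ∀ σ s X → len (draw σ s X) ≡ 2 * semilength s + len X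
  len-draw σ []      X = refl
  len-draw σ (p ∷ s) X = begin
    len (draw₁ σ p (draw σ s X))                        ≡⟨ len-draw₁ σ p _ ⟩
    2 * semilength₁ p + len (draw σ s X)                ≡⟨ cong (_+_ (2 * semilength₁ p)) (len-draw σ s X) ⟩
    2 * semilength₁ p + (2 * semilength s + len X)      ≡⟨ arith (semilength₁ p) (semilength s) (len X) ⟩
    2 * (semilength₁ p + semilength s) + len X          ∎
    where
    arith : ∀ a b c → 2 * a + (2 * b + c) ≡ 2 * (a + b) + c
    arith = solve-∀

endHeight-drawBlocks : ∀ bs → endHeight (+ 0) (drawBlocks bs) ≡ + 0
endHeight-drawBlocks []             = refl
endHeight-drawBlocks ((R , P) ∷ bs) = begin
  endHeight -[1+ 0 ] (draw below R (U ∷ draw above P (drawBlocks bs)))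
    ≡⟨ endHeight-draw below R 0 _ ⟩
  endHeight (+ 0) (draw above P (drawBlocks bs))
    ≡⟨ endHeight-draw above P 0 _ ⟩
  endHeight (+ 0) (drawBlocks bs)
    ≡⟨ endHeight-drawBlocks bs ⟩
  + 0 ∎

flawsFrom-drawBlocks : ∀ bs → flawsFrom (+ 0) (drawBlocks bs) ≡ blocksFlaws bs
flawsFrom-drawBlocks []             = refl
flawsFrom-drawBlocks ((R , P) ∷ bs) = begin
  flawsFrom -[1+ 0 ] (draw below R (U ∷ draw above P (drawBlocks bs)))
    ≡⟨ flawsFrom-draw-below R 0 _ ⟩
  semilength R + suc (flawsFrom (+ 0) (draw above P (drawBlocks bs)))
    ≡⟨ cong (λ f → semilength R + suc f) (flawsFrom-draw-above P 0 _) ⟩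
  semilength R + suc (flawsFrom (+ 0) (drawBlocks bs))
    ≡⟨ cong (λ f → semilength R + suc f) (flawsFrom-drawBlocks bs) ⟩
  semilength R + suc (blocksFlaws bs)
    ≡⟨ ℕ.+-suc (semilength R) (blocksFlaws bs) ⟩
  suc (semilength R + blocksFlaws bs) ∎

flawBlocksFrom-drawBlocks : ∀ bs → flawBlocksFrom (+ 0) (drawBlocks bs) ≡ length bs
flawBlocksFrom-drawBlocks []             = refl
flawBlocksFrom-drawBlocks ((R , P) ∷ bs) = cong suc (begin
  flawBlocksFrom -[1+ 0 ] (draw below R (U ∷ draw above P (drawBlocks bs)))
    ≡⟨ flawBlocksFrom-draw below R 0 _ ⟩
  flawBlocksFrom (+ 0) (draw above P (drawBlocks bs))
    ≡⟨ flawBlocksFrom-draw above P 0 _ ⟩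
  flawBlocksFrom (+ 0) (drawBlocks bs)
    ≡⟨ flawBlocksFrom-drawBlocks bs ⟩
  length bs ∎)

len-drawBlocks : ∀ bs → len (drawBlocks bs) ≡ 2 * blocksSize bs
len-drawBlocks []             = refl
len-drawBlocks ((R , P) ∷ bs) = begin
  suc (len (draw below R (U ∷ draw above P (drawBlocks bs))))
    ≡⟨ cong suc (len-draw below R _) ⟩
  suc (2 * r + suc (len (draw above P (drawBlocks bs))))
    ≡⟨ cong (λ l → suc (2 * r + suc l)) (len-draw above P _) ⟩
  suc (2 * r + suc (2 * p + len (drawBlocks bs)))
    ≡⟨ cong (λ l → suc (2 * r + suc (2 * p + l))) (len-drawBlocks bs) ⟩
  suc (2 * r + suc (2 * p + 2 * blocksSize bs))
    ≡⟨ arith r p (blocksSize bs) ⟩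
  2 * suc (r + p + blocksSize bs) ∎
  where
  r = semilength R
  p = semilength P
  arith : ∀ a b c → suc (2 * a + suc (2 * b + 2 * c)) ≡ 2 * suc (a + b + c)
  arith = solve-∀

endHeight-encode : ∀ c → endHeight (+ 0) (encode c) ≡ + 0
endHeight-encode (P , bs) = trans (endHeight-draw above P 0 _) (endHeight-drawBlocks bs)

flawsFrom-encode : ∀ c → flawsFrom (+ 0) (encode c) ≡ flaws c
flawsFrom-encode (P , bs) = trans (flawsFrom-draw-above P 0 _) (flawsFrom-drawBlocks bs)

flawBlocksFrom-encode : ∀ c → flawBlocksFrom (+ 0) (encode c) ≡ blockCount c
flawBlocksFrom-encode (P , bs) = trans (flawBlocksFrom-draw above P 0 _) (flawBlocksFrom-drawBlocks bs)

len-encode : ∀ c → len (encode c) ≡ 2 * size c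
len-encode (P , bs) = begin
  len (draw above P (drawBlocks bs))          ≡⟨ len-draw above P _ ⟩
  2 * semilength P + len (drawBlocks bs)      ≡⟨ cong (_+_ (2 * semilength P)) (len-drawBlocks bs) ⟩
  2 * semilength P + 2 * blocksSize bs        ≡⟨ ℕ.*-distribˡ-+ 2 (semilength P) (blocksSize bs) ⟨
  2 * (semilength P + blocksSize bs)          ∎

-- Parsing paths

endHeight-injective : ∀ p {a b} → endHeight a p ≡ endHeight b p → a ≡ b
endHeight-injective []      eq = eq
endHeight-injective (U ∷ p) {a} {b} eq =
  ∙-cancelʳ ℤ.1ℤ a b (endHeight-injective p eq)
endHeight-injective (H ∷ p) eq = endHeight-injective p eq
endHeight-injective (D ∷ p) {a} {b} eq =
  ∙-cancelʳ (ℤ.- ℤ.1ℤ) a b (endHeight-injective p eq)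

-- A path is parsed from its right end.  A reading is the parse of a suffix: a stack of
-- unfinished Schröder paths, one for each level between its starting height and the axis.
data Reading : Set where
  nonneg : Schroder → List Schroder → List Block → Reading
  neg    : Schroder → List Schroder → Schroder → List Block → Reading

returnFromAbove : List Schroder → List Block → List Step
returnFromAbove []       bs = drawBlocks bs
returnFromAbove (s ∷ ss) bs = D ∷ draw above s (returnFromAbove ss bs)

returnFromBelow : List Schroder → Schroder → List Block → List Step
returnFromBelow []       P bs = draw above P (drawBlocks bs)
returnFromBelow (r ∷ rs) P bs = draw below r (U ∷ returnFromBelow rs P bs)

pathOf : Reading → List Step
pathOf (nonneg s ss bs) = draw above s (returnFromAbove ss bs)
pathOf (neg r rs P bs)  = draw below r (U ∷ returnFromBelow rs P bs)

heightOf : Reading → ℤ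
heightOf (nonneg _ ss _) = + length ss
heightOf (neg _ rs _ _)  = -[1+ length rs ]

pushStep : Step → Reading → Reading
pushStep H (nonneg s ss bs)         = nonneg (flat ∷ s) ss bs
pushStep H (neg r rs P bs)          = neg (flat ∷ r) rs P bs
pushStep D (nonneg s ss bs)         = nonneg [] (s ∷ ss) bs
pushStep D (neg r [] P bs)          = nonneg [] [] ((r , P) ∷ bs)
pushStep D (neg r (r′ ∷ rs) P bs)   = neg (lift r ∷ r′) rs P bs
pushStep U (nonneg s [] bs)         = neg [] [] s bs
pushStep U (nonneg s (s′ ∷ ss) bs)  = nonneg (lift s ∷ s′) ss bs
pushStep U (neg r rs P bs)          = neg [] (r ∷ rs) P bs

pathOf-pushStep : ∀ x st → pathOf (pushStep x st) ≡ x ∷ pathOf st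
pathOf-pushStep H (nonneg s ss bs)        = refl
pathOf-pushStep H (neg r rs P bs)         = refl
pathOf-pushStep D (nonneg s ss bs)        = refl
pathOf-pushStep D (neg r [] P bs)         = refl
pathOf-pushStep D (neg r (r′ ∷ rs) P bs)  = refl
pathOf-pushStep U (nonneg s [] bs)        = refl
pathOf-pushStep U (nonneg s (s′ ∷ ss) bs) = refl
pathOf-pushStep U (neg r rs P bs)         = refl

read : List Step → Reading
read = foldr pushStep (nonneg [] [] [])

pathOf-read : ∀ p → pathOf (read p) ≡ p
pathOf-read []      = refl
pathOf-read (x ∷ p) = trans (pathOf-pushStep x (read p)) (cong (x ∷_) (pathOf-read p))

endHeight-returnFromAbove : ∀ ss bs → endHeight (+ length ss) (returnFromAbove ss bs) ≡ + 0
endHeight-returnFromAbove []       bs = endHeight-drawBlocks bs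
endHeight-returnFromAbove (s ∷ ss) bs =
  trans (endHeight-draw above s _ _) (endHeight-returnFromAbove ss bs)

endHeight-returnFromBelow : ∀ rs P bs →
  endHeight (-[1+ length rs ] ℤ.+ ℤ.1ℤ) (returnFromBelow rs P bs) ≡ + 0
endHeight-returnFromBelow []       P bs = endHeight-encode (P , bs)
endHeight-returnFromBelow (r ∷ rs) P bs =
  trans (endHeight-draw below r _ _) (endHeight-returnFromBelow rs P bs)

endHeight-pathOf : ∀ st → endHeight (heightOf st) (pathOf st) ≡ + 0
endHeight-pathOf (nonneg s ss bs) =
  trans (endHeight-draw above s _ _) (endHeight-returnFromAbove ss bs)
endHeight-pathOf (neg r rs P bs) =
  trans (endHeight-draw below r _ _) (endHeight-returnFromBelow rs P bs)

-- Readings of paths that do not end on the axis give a meaningless factorisation.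
factorisationOf : Reading → Factorisation
factorisationOf (nonneg s _ bs) = (s , bs)
factorisationOf (neg _ _ _ _)   = ([] , [])

factorise : List Step → Factorisation
factorise p = factorisationOf (read p)

heightOf-read : ∀ p → endHeight (+ 0) p ≡ + 0 → heightOf (read p) ≡ + 0
heightOf-read p returns = endHeight-injective p (begin
  endHeight (heightOf (read p)) p
    ≡⟨ cong (endHeight (heightOf (read p))) (pathOf-read p) ⟨
  endHeight (heightOf (read p)) (pathOf (read p))
    ≡⟨ endHeight-pathOf (read p) ⟩
  + 0
    ≡⟨ returns ⟨
  endHeight (+ 0) p ∎)

encode-factorisationOf : ∀ st → heightOf st ≡ + 0 → encode (factorisationOf st) ≡ pathOf st
encode-factorisationOf (nonneg s [] bs) _ = refl

encode-factorise : ∀ p → endHeight (+ 0) p ≡ + 0 → encode (factorise p) ≡ p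
encode-factorise p returns =
  trans (encode-factorisationOf (read p) (heightOf-read p returns)) (pathOf-read p)

read-draw-above : ∀ s X {s₀ ss bs} → read X ≡ nonneg s₀ ss bs →
  read (draw above s X) ≡ nonneg (s ++ s₀) ss bs
read-draw-above []             X eq = eq
read-draw-above (flat ∷ s)     X eq = cong (pushStep H) (read-draw-above s X eq)
read-draw-above (lift t ∷ s) X {s₀} {ss} {bs} eq = begin
  pushStep U (read (draw above t (D ∷ draw above s X)))
    ≡⟨ cong (pushStep U) (read-draw-above t _ (cong (pushStep D) (read-draw-above s X eq))) ⟩
  nonneg (lift (t ++ []) ∷ s ++ s₀) ss bs
    ≡⟨ cong (λ t′ → nonneg (lift t′ ∷ s ++ s₀) ss bs) (++-identityʳ t) ⟩
  nonneg (lift t ∷ s ++ s₀) ss bs ∎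

read-draw-below : ∀ r X {r₀ rs P bs} → read X ≡ neg r₀ rs P bs →
  read (draw below r X) ≡ neg (r ++ r₀) rs P bs
read-draw-below []             X eq = eq
read-draw-below (flat ∷ r)     X eq = cong (pushStep H) (read-draw-below r X eq)
read-draw-below (lift t ∷ r) X {r₀} {rs} {P} {bs} eq = begin
  pushStep D (read (draw below t (U ∷ draw below r X)))
    ≡⟨ cong (pushStep D) (read-draw-below t _ (cong (pushStep U) (read-draw-below r X eq))) ⟩
  neg (lift (t ++ []) ∷ r ++ r₀) rs P bs
    ≡⟨ cong (λ t′ → neg (lift t′ ∷ r ++ r₀) rs P bs) (++-identityʳ t) ⟩
  neg (lift t ∷ r ++ r₀) rs P bs ∎

read-drawBlocks : ∀ bs → read (drawBlocks bs) ≡ nonneg [] [] bs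
read-drawBlocks []             = refl
read-drawBlocks ((R , P) ∷ bs) = begin
  pushStep D (read (draw below R (U ∷ draw above P (drawBlocks bs))))
    ≡⟨ cong (pushStep D) (read-draw-below R _
         (cong (pushStep U) (read-draw-above P _ (read-drawBlocks bs)))) ⟩
  nonneg [] [] ((R ++ [] , P ++ []) ∷ bs)
    ≡⟨ cong₂ (λ R′ P′ → nonneg [] [] ((R′ , P′) ∷ bs)) (++-identityʳ R) (++-identityʳ P) ⟩
  nonneg [] [] ((R , P) ∷ bs) ∎

factorise-encode : ∀ c → factorise (encode c) ≡ c
factorise-encode (P , bs) =
  cong factorisationOf (trans (read-draw-above P _ (read-drawBlocks bs))
                              (cong (λ P′ → nonneg P′ [] bs) (++-identityʳ P)))

freeSchroder↔factorisation : ∀ n m k → FreeSchroder n m k ↔ FactorisationWith n m k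
freeSchroder↔factorisation n m k = ↔-restrict
  (×-irrelevant ℕ.≡-irrelevant (×-irrelevant ℤ-≡-irrelevant (×-irrelevant ℕ.≡-irrelevant ℕ.≡-irrelevant)))
  (×-irrelevant ℕ.≡-irrelevant (×-irrelevant ℕ.≡-irrelevant ℕ.≡-irrelevant))
  factorise encode
  (λ {p} (l , e , f , b) → statistics-of-encode (factorise p) (encode-factorise p e) l f b)
  (λ {c} (s , f , b) →
     trans (len-encode c) (cong (2 *_) s) , endHeight-encode c ,
     trans (flawsFrom-encode c) f , trans (flawBlocksFrom-encode c) b)
  (λ {p} (_ , e , _) → encode-factorise p e)
  (λ _ → factorise-encode _)
  where
  statistics-of-encode : ∀ c {p} → encode c ≡ p →
    len p ≡ 2 * n → flawsFrom (+ 0) p ≡ m → flawBlocksFrom (+ 0) p ≡ k →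
    (size c ≡ n) × (flaws c ≡ m) × (blockCount c ≡ k)
  statistics-of-encode c refl l f b =
    ℕ.*-cancelˡ-≡ (size c) n 2 (trans (sym (len-encode c)) l) ,
    trans (sym (flawsFrom-encode c)) f ,
    trans (sym (flawBlocksFrom-encode c)) b

-- Vertex lists in right-to-left preorder

rlForest-++ : ∀ d ts us → rlForest d (ts ++ us) ≡ rlForest d us ++ rlForest d ts
rlForest-++ d []       us = sym (++-identityʳ _)
rlForest-++ d (t ∷ ts) us = begin
  rlForest d (ts ++ us) ++ rlPreorder d t
    ≡⟨ cong (_++ rlPreorder d t) (rlForest-++ d ts us) ⟩
  (rlForest d us ++ rlForest d ts) ++ rlPreorder d t
    ≡⟨ ++-assoc (rlForest d us) (rlForest d ts) (rlPreorder d t) ⟩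
  rlForest d us ++ rlForest d ts ++ rlPreorder d t ∎

countDist-++ : ∀ vs ws → countDist (vs ++ ws) ≡ countDist vs + countDist ws
countDist-++ []       ws = refl
countDist-++ (v ∷ vs) ws = trans (cong (_+_ (b2n (isDist (VInfo.mark v)))) (countDist-++ vs ws))
                                 (sym (ℕ.+-assoc (b2n (isDist (VInfo.mark v))) _ _))

allColorOK-++ : ∀ vs ws → allColorOK false (vs ++ ws) ≡ allColorOK false vs ∧ allColorOK false ws
allColorOK-++ []       ws = refl
allColorOK-++ (v ∷ vs) ws = trans (cong (colorOK false v ∧_) (allColorOK-++ vs ws))
                                  (sym (Bool.∧-assoc (colorOK false v) _ _))

depthW-++-none : ∀ vs ws → countDist vs ≡ 0 → depthW (vs ++ ws) ≡ depthW ws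
depthW-++-none []       ws _ = refl
depthW-++-none (v ∷ vs) ws e with isDist (VInfo.mark v)
depthW-++-none (v ∷ vs) ws e  | false = depthW-++-none vs ws e
depthW-++-none (v ∷ vs) ws () | true

depthW-++-some : ∀ vs ws {k} → countDist vs ≡ suc k → depthW (vs ++ ws) ≡ depthW vs
depthW-++-some (v ∷ vs) ws e with isDist (VInfo.mark v)
... | false = depthW-++-some vs ws e
... | true  = refl

labelW-++-none : ∀ vs ws → countDist vs ≡ 0 → labelW (vs ++ ws) ≡ length vs + labelW ws
labelW-++-none []       ws _ = refl
labelW-++-none (v ∷ vs) ws e with isDist (VInfo.mark v)
labelW-++-none (v ∷ vs) ws e  | false = cong suc (labelW-++-none vs ws e)
labelW-++-none (v ∷ vs) ws () | true

labelW-++-some : ∀ vs ws {k} → countDist vs ≡ suc k → labelW (vs ++ ws) ≡ labelW vs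
labelW-++-some (v ∷ vs) ws e with isDist (VInfo.mark v)
... | false = cong suc (labelW-++-some vs ws e)
... | true  = refl

labelW<length : ∀ vs {k} → countDist vs ≡ suc k → labelW vs < length vs
labelW<length (v ∷ vs) e with isDist (VInfo.mark v)
... | false = s≤s (labelW<length vs e)
... | true  = s≤s z≤n

countPrefix-none : ∀ lw i vs → lw < i → countPrefix lw i vs ≡ 0
countPrefix-none lw i []       _    = refl
countPrefix-none lw i (v ∷ vs) lw<i rewrite ≤ᵇ-false lw<i | Bool.∧-zeroʳ (not (i ≡ᵇ 0)) =
  countPrefix-none lw (suc i) vs (ℕ.m<n⇒m<1+n lw<i)

countPrefix-all : ∀ i j vs → j ≤ length vs → countPrefix (i + j) (suc i) vs ≡ j
countPrefix-all i zero    vs       _ =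
  countPrefix-none (i + 0) (suc i) vs (s≤s (ℕ.≤-reflexive (ℕ.+-identityʳ i)))
countPrefix-all i (suc j) (v ∷ vs) (s≤s j≤len)
  rewrite ℕ.+-suc i j | ≤ᵇ-true {suc i} {suc (i + j)} (s≤s (ℕ.m≤m+n i j)) =
  cong suc (countPrefix-all (suc i) j vs j≤len)

countPrefix-labelW : ∀ vs {k} → countDist vs ≡ suc k → countPrefix (labelW vs) 0 vs ≡ labelW vs
countPrefix-labelW vs@(_ ∷ rest) hasW with labelW<length vs hasW
... | s≤s labelW≤len = countPrefix-all 0 (labelW vs) rest labelW≤len

-- Trees of factorisations

mutual
  tree₁ : Prime → MTree
  tree₁ flat              = node red []
  tree₁ (lift [])         = node blue []
  tree₁ (lift s@(_ ∷ _))  = node plain (forest s)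

  forest : Schroder → List MTree
  forest []      = []
  forest (p ∷ s) = tree₁ p ∷ forest s

mutual
  primeOf : MTree → Prime
  primeOf (node red _)           = flat
  primeOf (node blue _)          = lift []
  primeOf (node plain ts)        = lift (schroderOf ts)
  primeOf (node distinguished ts) = lift (schroderOf ts)

  schroderOf : List MTree → Schroder
  schroderOf []       = []
  schroderOf (t ∷ ts) = primeOf t ∷ schroderOf ts

mutual
  primeOf-tree₁ : ∀ p → primeOf (tree₁ p) ≡ p
  primeOf-tree₁ flat             = refl
  primeOf-tree₁ (lift [])        = refl
  primeOf-tree₁ (lift s@(_ ∷ _)) = cong lift (schroderOf-forest s)

  schroderOf-forest : ∀ s → schroderOf (forest s) ≡ s
  schroderOf-forest []      = refl
  schroderOf-forest (p ∷ s) = cong₂ _∷_ (primeOf-tree₁ p) (schroderOf-forest s)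

tree : Schroder → List Block → MTree
tree P []               = node distinguished (forest P)
tree P ((R , P′) ∷ bs)  = node plain (forest P ++ tree P′ bs ∷ forest R)

treeOf : Factorisation → MTree
treeOf (P , bs) = tree P bs

mutual
  countDistᵀ : MTree → ℕ
  countDistᵀ (node m ts) = b2n (isDist m) + countDistᶠ ts

  countDistᶠ : List MTree → ℕ
  countDistᶠ []       = 0
  countDistᶠ (t ∷ ts) = countDistᶠ ts + countDistᵀ t

mutual
  allColorOKᵀ : MTree → Bool
  allColorOKᵀ (node m ts) = colorOK false (vinfo m 0 (length ts)) ∧ allColorOKᶠ ts

  allColorOKᶠ : List MTree → Bool
  allColorOKᶠ []       = true
  allColorOKᶠ (t ∷ ts) = allColorOKᶠ ts ∧ allColorOKᵀ t

mutual
  sizeᵀ : MTree → ℕ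
  sizeᵀ (node m ts) = suc (sizeᶠ ts)

  sizeᶠ : List MTree → ℕ
  sizeᶠ []       = 0
  sizeᶠ (t ∷ ts) = sizeᶠ ts + sizeᵀ t

mutual
  countDist-rlPreorder : ∀ d t → countDist (rlPreorder d t) ≡ countDistᵀ t
  countDist-rlPreorder d (node m ts) = cong (_+_ (b2n (isDist m))) (countDist-rlForest (suc d) ts)

  countDist-rlForest : ∀ d ts → countDist (rlForest d ts) ≡ countDistᶠ ts
  countDist-rlForest d []       = refl
  countDist-rlForest d (t ∷ ts) = trans (countDist-++ (rlForest d ts) (rlPreorder d t))
    (cong₂ _+_ (countDist-rlForest d ts) (countDist-rlPreorder d t))

mutual
  allColorOK-rlPreorder : ∀ d t → allColorOK false (rlPreorder d t) ≡ allColorOKᵀ t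
  allColorOK-rlPreorder d (node m ts) =
    cong (colorOK false (vinfo m 0 (length ts)) ∧_) (allColorOK-rlForest (suc d) ts)

  allColorOK-rlForest : ∀ d ts → allColorOK false (rlForest d ts) ≡ allColorOKᶠ ts
  allColorOK-rlForest d []       = refl
  allColorOK-rlForest d (t ∷ ts) = trans (allColorOK-++ (rlForest d ts) (rlPreorder d t))
    (cong₂ _∧_ (allColorOK-rlForest d ts) (allColorOK-rlPreorder d t))

mutual
  length-rlPreorder : ∀ d t → length (rlPreorder d t) ≡ sizeᵀ t
  length-rlPreorder d (node m ts) = cong suc (length-rlForest (suc d) ts)

  length-rlForest : ∀ d ts → length (rlForest d ts) ≡ sizeᶠ ts
  length-rlForest d []       = refl
  length-rlForest d (t ∷ ts) = trans (length-++ (rlForest d ts))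
    (cong₂ _+_ (length-rlForest d ts) (length-rlPreorder d t))

countDistᶠ-++ : ∀ ts us → countDistᶠ (ts ++ us) ≡ countDistᶠ ts + countDistᶠ us
countDistᶠ-++ []       us = refl
countDistᶠ-++ (t ∷ ts) us =
  trans (cong (_+ countDistᵀ t) (countDistᶠ-++ ts us))
        (+-Props.xy∙z≈xz∙y (countDistᶠ ts) (countDistᶠ us) (countDistᵀ t))

allColorOKᶠ-++ : ∀ ts us → allColorOKᶠ (ts ++ us) ≡ allColorOKᶠ ts ∧ allColorOKᶠ us
allColorOKᶠ-++ []       us = refl
allColorOKᶠ-++ (t ∷ ts) us =
  trans (cong (_∧ allColorOKᵀ t) (allColorOKᶠ-++ ts us))
        (∧-Props.xy∙z≈xz∙y (allColorOKᶠ ts) (allColorOKᶠ us) (allColorOKᵀ t))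

sizeᶠ-++ : ∀ ts us → sizeᶠ (ts ++ us) ≡ sizeᶠ ts + sizeᶠ us
sizeᶠ-++ []       us = refl
sizeᶠ-++ (t ∷ ts) us =
  trans (cong (_+ sizeᵀ t) (sizeᶠ-++ ts us))
        (+-Props.xy∙z≈xz∙y (sizeᶠ ts) (sizeᶠ us) (sizeᵀ t))

mutual
  countDistᵀ-tree₁ : ∀ p → countDistᵀ (tree₁ p) ≡ 0
  countDistᵀ-tree₁ flat             = refl
  countDistᵀ-tree₁ (lift [])        = refl
  countDistᵀ-tree₁ (lift s@(_ ∷ _)) = countDistᶠ-forest s

  countDistᶠ-forest : ∀ s → countDistᶠ (forest s) ≡ 0
  countDistᶠ-forest []      = refl
  countDistᶠ-forest (p ∷ s) = cong₂ _+_ (countDistᶠ-forest s) (countDistᵀ-tree₁ p)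

mutual
  allColorOKᵀ-tree₁ : ∀ p → allColorOKᵀ (tree₁ p) ≡ true
  allColorOKᵀ-tree₁ flat             = refl
  allColorOKᵀ-tree₁ (lift [])        = refl
  allColorOKᵀ-tree₁ (lift s@(_ ∷ _)) = allColorOKᶠ-forest s

  allColorOKᶠ-forest : ∀ s → allColorOKᶠ (forest s) ≡ true
  allColorOKᶠ-forest []      = refl
  allColorOKᶠ-forest (p ∷ s) = cong₂ _∧_ (allColorOKᶠ-forest s) (allColorOKᵀ-tree₁ p)

mutual
  sizeᵀ-tree₁ : ∀ p → sizeᵀ (tree₁ p) ≡ semilength₁ p
  sizeᵀ-tree₁ flat             = refl
  sizeᵀ-tree₁ (lift [])        = refl
  sizeᵀ-tree₁ (lift s@(_ ∷ _)) = cong suc (sizeᶠ-forest s)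

  sizeᶠ-forest : ∀ s → sizeᶠ (forest s) ≡ semilength s
  sizeᶠ-forest []      = refl
  sizeᶠ-forest (p ∷ s) = trans (cong₂ _+_ (sizeᶠ-forest s) (sizeᵀ-tree₁ p))
                               (ℕ.+-comm (semilength s) (semilength₁ p))

countDistᵀ-tree : ∀ P bs → countDistᵀ (tree P bs) ≡ 1
countDistᵀ-tree P []              = cong suc (countDistᶠ-forest P)
countDistᵀ-tree P ((R , P′) ∷ bs) = begin
  countDistᶠ (forest P ++ tree P′ bs ∷ forest R)
    ≡⟨ countDistᶠ-++ (forest P) (tree P′ bs ∷ forest R) ⟩
  countDistᶠ (forest P) + (countDistᶠ (forest R) + countDistᵀ (tree P′ bs))
    ≡⟨ cong₂ (λ a b → a + (b + countDistᵀ (tree P′ bs))) (countDistᶠ-forest P) (countDistᶠ-forest R) ⟩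
  countDistᵀ (tree P′ bs)
    ≡⟨ countDistᵀ-tree P′ bs ⟩
  1 ∎

colorOK-distinguished : ∀ c → colorOK false (vinfo distinguished 0 c) ≡ true
colorOK-distinguished zero    = refl
colorOK-distinguished (suc c) = refl

colorOK-plain-++-∷ : ∀ (ts : List MTree) u us → colorOK false (vinfo plain 0 (length (ts ++ u ∷ us))) ≡ true
colorOK-plain-++-∷ []      u us = refl
colorOK-plain-++-∷ (_ ∷ _) u us = refl

mutual
  allColorOKᵀ-tree : ∀ P bs → allColorOKᵀ (tree P bs) ≡ true
  allColorOKᵀ-tree P [] =
    cong₂ _∧_ (colorOK-distinguished (length (forest P))) (allColorOKᶠ-forest P)
  allColorOKᵀ-tree P ((R , P′) ∷ bs) =
    cong₂ _∧_ (colorOK-plain-++-∷ (forest P) (tree P′ bs) (forest R)) (allColorOKᶠ-branches P R P′ bs)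

  allColorOKᶠ-branches : ∀ P R P′ bs → allColorOKᶠ (forest P ++ tree P′ bs ∷ forest R) ≡ true
  allColorOKᶠ-branches P R P′ bs = begin
    allColorOKᶠ (forest P ++ tree P′ bs ∷ forest R)
      ≡⟨ allColorOKᶠ-++ (forest P) (tree P′ bs ∷ forest R) ⟩
    allColorOKᶠ (forest P) ∧ (allColorOKᶠ (forest R) ∧ allColorOKᵀ (tree P′ bs))
      ≡⟨ cong₂ (λ a b → a ∧ (b ∧ allColorOKᵀ (tree P′ bs))) (allColorOKᶠ-forest P) (allColorOKᶠ-forest R) ⟩
    allColorOKᵀ (tree P′ bs)
      ≡⟨ allColorOKᵀ-tree P′ bs ⟩
    true ∎

sizeᵀ-tree : ∀ P bs → sizeᵀ (tree P bs) ≡ suc (size (P , bs))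
sizeᵀ-tree P []              = cong suc (trans (sizeᶠ-forest P) (sym (ℕ.+-identityʳ (semilength P))))
sizeᵀ-tree P ((R , P′) ∷ bs) = cong suc (begin
  sizeᶠ (forest P ++ tree P′ bs ∷ forest R)
    ≡⟨ sizeᶠ-++ (forest P) (tree P′ bs ∷ forest R) ⟩
  sizeᶠ (forest P) + (sizeᶠ (forest R) + sizeᵀ (tree P′ bs))
    ≡⟨ cong₂ (λ a b → a + (b + sizeᵀ (tree P′ bs))) (sizeᶠ-forest P) (sizeᶠ-forest R) ⟩
  semilength P + (semilength R + sizeᵀ (tree P′ bs))
    ≡⟨ cong (λ s → semilength P + (semilength R + s)) (sizeᵀ-tree P′ bs) ⟩
  semilength P + (semilength R + suc (semilength P′ + blocksSize bs))
    ≡⟨ arith (semilength P) (semilength R) (semilength P′) (blocksSize bs) ⟩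
  semilength P + suc (semilength R + semilength P′ + blocksSize bs) ∎)
  where
  arith : ∀ p r q x → p + (r + suc (q + x)) ≡ p + suc (r + q + x)
  arith = solve-∀

rlPreorder-tree-∷ : ∀ d P R P′ bs →
  rlPreorder d (tree P ((R , P′) ∷ bs)) ≡
  vinfo plain d (length (forest P ++ tree P′ bs ∷ forest R)) ∷
    rlForest (suc d) (forest R) ++ rlPreorder (suc d) (tree P′ bs) ++ rlForest (suc d) (forest P)
rlPreorder-tree-∷ d P R P′ bs = cong (vinfo plain d (length (forest P ++ tree P′ bs ∷ forest R)) ∷_) (begin
  rlForest (suc d) (forest P ++ tree P′ bs ∷ forest R)
    ≡⟨ rlForest-++ (suc d) (forest P) (tree P′ bs ∷ forest R) ⟩
  (rlForest (suc d) (forest R) ++ rlPreorder (suc d) (tree P′ bs)) ++ rlForest (suc d) (forest P)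
    ≡⟨ ++-assoc (rlForest (suc d) (forest R)) _ _ ⟩
  rlForest (suc d) (forest R) ++ rlPreorder (suc d) (tree P′ bs) ++ rlForest (suc d) (forest P) ∎)

countDist-rlForest-forest : ∀ d s → countDist (rlForest d (forest s)) ≡ 0
countDist-rlForest-forest d s = trans (countDist-rlForest d (forest s)) (countDistᶠ-forest s)

countDist-rlPreorder-tree : ∀ d P bs → countDist (rlPreorder d (tree P bs)) ≡ 1
countDist-rlPreorder-tree d P bs = trans (countDist-rlPreorder d (tree P bs)) (countDistᵀ-tree P bs)

depthW-tree : ∀ d P bs → depthW (rlPreorder d (tree P bs)) ≡ d + length bs
depthW-tree d P []              = sym (ℕ.+-identityʳ d)
depthW-tree d P ((R , P′) ∷ bs) = begin
  depthW (rlPreorder d (tree P ((R , P′) ∷ bs)))  ≡⟨ cong depthW (rlPreorder-tree-∷ d P R P′ bs) ⟩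
  depthW (right ++ stem ++ left)                   ≡⟨ depthW-++-none right _ (countDist-rlForest-forest (suc d) R) ⟩
  depthW (stem ++ left)                            ≡⟨ depthW-++-some stem left (countDist-rlPreorder-tree (suc d) P′ bs) ⟩
  depthW stem                                      ≡⟨ depthW-tree (suc d) P′ bs ⟩
  suc d + length bs                                ≡⟨ ℕ.+-suc d (length bs) ⟨
  d + length ((R , P′) ∷ bs)                       ∎
  where
  right = rlForest (suc d) (forest R)
  stem  = rlPreorder (suc d) (tree P′ bs)
  left  = rlForest (suc d) (forest P)

labelW-tree : ∀ d P bs → labelW (rlPreorder d (tree P bs)) ≡ flaws (P , bs)
labelW-tree d P []              = refl
labelW-tree d P ((R , P′) ∷ bs) = begin
  labelW (rlPreorder d (tree P ((R , P′) ∷ bs)))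
    ≡⟨ cong labelW (rlPreorder-tree-∷ d P R P′ bs) ⟩
  suc (labelW (right ++ stem ++ left))
    ≡⟨ cong suc (labelW-++-none right _ (countDist-rlForest-forest (suc d) R)) ⟩
  suc (length right + labelW (stem ++ left))
    ≡⟨ cong (λ l → suc (length right + l)) (labelW-++-some stem left (countDist-rlPreorder-tree (suc d) P′ bs)) ⟩
  suc (length right + labelW stem)
    ≡⟨ cong₂ (λ a b → suc (a + b)) (trans (length-rlForest (suc d) (forest R)) (sizeᶠ-forest R))
                                   (labelW-tree (suc d) P′ bs) ⟩
  suc (semilength R + blocksFlaws bs) ∎
  where
  right = rlForest (suc d) (forest R)
  stem  = rlPreorder (suc d) (tree P′ bs)
  left  = rlForest (suc d) (forest P)

edges-treeOf : ∀ c → edges (treeOf c) ≡ size c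
edges-treeOf (P , bs) = cong (_∸ 1) (trans (length-rlPreorder 0 (tree P bs)) (sizeᵀ-tree P bs))

stemSize-treeOf : ∀ c → stemSize (treeOf c) ≡ blockCount c
stemSize-treeOf (P , bs) = depthW-tree 0 P bs

prefixEdges-treeOf : ∀ c → prefixEdges (treeOf c) ≡ flaws c
prefixEdges-treeOf (P , bs) =
  trans (countPrefix-labelW (vertices (tree P bs)) (countDist-rlPreorder-tree 0 P bs)) (labelW-tree 0 P bs)

wellFormed-treeOf : ∀ c → WellFormed (treeOf c)
wellFormed-treeOf (P , bs) = countDist-rlPreorder-tree 0 P bs , allColorOK-vertices P bs
  where
  allColorOK-vertices : ∀ P bs → allColorOK true (vertices (tree P bs)) ≡ true
  allColorOK-vertices P []              = trans (allColorOK-rlForest 1 (forest P)) (allColorOKᶠ-forest P)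
  allColorOK-vertices P ((R , P′) ∷ bs) =
    trans (allColorOK-rlForest 1 (forest P ++ tree P′ bs ∷ forest R)) (allColorOKᶠ-branches P R P′ bs)

-- Decoding trees

mutual
  factorisationOfTree : MTree → Factorisation
  factorisationOfTree (node distinguished ts) = (schroderOf ts , [])
  factorisationOfTree (node _ ts)             = factorisationOfChildren ts

  factorisationOfChildren : List MTree → Factorisation
  factorisationOfChildren []       = ([] , [])
  factorisationOfChildren (t ∷ ts) = factorisationFrom (countDistᵀ t) t ts

  -- The first child containing w is the stem child: the children to its left form
  -- the Schröder path P of the current block, those to its right its flaw part R.
  factorisationFrom : ℕ → MTree → List MTree → Factorisation
  factorisationFrom zero    t ts = let (P , bs) = factorisationOfChildren ts in (primeOf t ∷ P , bs)
  factorisationFrom (suc _) t ts = let (P , bs) = factorisationOfTree t in ([] , (schroderOf ts , P) ∷ bs)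

factorisationOfChildren-forest-++ : ∀ P us →
  factorisationOfChildren (forest P ++ us) ≡
  (P ++ proj₁ (factorisationOfChildren us) , proj₂ (factorisationOfChildren us))
factorisationOfChildren-forest-++ []      us = refl
factorisationOfChildren-forest-++ (p ∷ P) us
  rewrite countDistᵀ-tree₁ p | factorisationOfChildren-forest-++ P us | primeOf-tree₁ p = refl

factorisationOfTree-tree : ∀ P bs → factorisationOfTree (tree P bs) ≡ (P , bs)
factorisationOfTree-tree P []              = cong (_, []) (schroderOf-forest P)
factorisationOfTree-tree P ((R , P′) ∷ bs)
  rewrite factorisationOfChildren-forest-++ P (tree P′ bs ∷ forest R)
        | countDistᵀ-tree P′ bs | factorisationOfTree-tree P′ bs | schroderOf-forest R
        | ++-identityʳ P = refl

mutual
  tree₁-primeOf : ∀ t → countDistᵀ t ≡ 0 → allColorOKᵀ t ≡ true → tree₁ (primeOf t) ≡ t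
  tree₁-primeOf (node distinguished ts)  ()
  tree₁-primeOf (node red [])            _ _  = refl
  tree₁-primeOf (node red (_ ∷ _))       _ ()
  tree₁-primeOf (node blue [])           _ _  = refl
  tree₁-primeOf (node blue (_ ∷ _))      _ ()
  tree₁-primeOf (node plain [])          _ ()
  tree₁-primeOf (node plain ts@(_ ∷ _))  noW ok =
    cong (node plain) (forest-schroderOf ts noW ok)

  forest-schroderOf : ∀ ts → countDistᶠ ts ≡ 0 → allColorOKᶠ ts ≡ true → forest (schroderOf ts) ≡ ts
  forest-schroderOf []       _   _  = refl
  forest-schroderOf (t ∷ ts) noW ok = cong₂ _∷_
    (tree₁-primeOf t (ℕ.m+n≡0⇒n≡0 (countDistᶠ ts) noW) (Bool.∧-conicalʳ _ _ ok))
    (forest-schroderOf ts (ℕ.m+n≡0⇒m≡0 (countDistᶠ ts) noW) (Bool.∧-conicalˡ _ _ ok))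

tree-∷ : ∀ p P bs {ts} → tree P bs ≡ node plain ts → tree (p ∷ P) bs ≡ node plain (tree₁ p ∷ ts)
tree-∷ p P ((R , P′) ∷ bs) refl = refl

mutual
  treeOf-factorisationOfTree : ∀ t → countDistᵀ t ≡ 1 → allColorOKᵀ t ≡ true →
    treeOf (factorisationOfTree t) ≡ t
  treeOf-factorisationOfTree (node distinguished ts) oneW ok =
    cong (node distinguished)
      (forest-schroderOf ts (ℕ.suc-injective oneW) (Bool.∧-conicalʳ _ _ ok))
  treeOf-factorisationOfTree (node plain ts) oneW ok =
    treeOf-factorisationOfChildren ts oneW (Bool.∧-conicalʳ _ _ ok)
  treeOf-factorisationOfTree (node red [])        ()
  treeOf-factorisationOfTree (node red (_ ∷ _))   _ ()
  treeOf-factorisationOfTree (node blue [])       ()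
  treeOf-factorisationOfTree (node blue (_ ∷ _))  _ ()

  treeOf-factorisationOfChildren : ∀ ts → countDistᶠ ts ≡ 1 → allColorOKᶠ ts ≡ true →
    treeOf (factorisationOfChildren ts) ≡ node plain ts
  treeOf-factorisationOfChildren (t ∷ ts) oneW ok with countDistᵀ t in countT
  ... | zero  = trans
    (tree-∷ (primeOf t) _ _
      (treeOf-factorisationOfChildren ts (trans (sym (ℕ.+-identityʳ _)) oneW) (Bool.∧-conicalˡ _ _ ok)))
    (cong (λ t′ → node plain (t′ ∷ ts)) (tree₁-primeOf t countT (Bool.∧-conicalʳ _ _ ok)))
  ... | suc j with m+[1+n]≡1⇒m≡0×n≡0 (countDistᶠ ts) oneW
  ... | noWInTs , refl = cong₂ (λ t′ ts′ → node plain (t′ ∷ ts′))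
    (treeOf-factorisationOfTree t countT (Bool.∧-conicalʳ _ _ ok))
    (forest-schroderOf ts noWInTs (Bool.∧-conicalˡ _ _ ok))

treeOf-factorisationOfTree-wellFormed : ∀ t → WellFormed t → treeOf (factorisationOfTree t) ≡ t
treeOf-factorisationOfTree-wellFormed (node distinguished ts) (oneW , ok) =
  cong (node distinguished) (forest-schroderOf ts
    (trans (sym (countDist-rlForest 1 ts)) (ℕ.suc-injective oneW))
    (trans (sym (allColorOK-rlForest 1 ts)) ok))
treeOf-factorisationOfTree-wellFormed (node plain ts) (oneW , ok) =
  treeOf-factorisationOfChildren ts
    (trans (sym (countDist-rlForest 1 ts)) oneW)
    (trans (sym (allColorOK-rlForest 1 ts)) ok)
treeOf-factorisationOfTree-wellFormed (node red ts)  (_ , ())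
treeOf-factorisationOfTree-wellFormed (node blue ts) (_ , ())

factorisation↔tree : ∀ n m k → FactorisationWith n m k ↔ LCDRTree n k m
factorisation↔tree n m k = ↔-restrict
  (×-irrelevant ℕ.≡-irrelevant (×-irrelevant ℕ.≡-irrelevant ℕ.≡-irrelevant))
  (×-irrelevant (×-irrelevant ℕ.≡-irrelevant Bool-≡-irrelevant)
                (×-irrelevant ℕ.≡-irrelevant (×-irrelevant ℕ.≡-irrelevant ℕ.≡-irrelevant)))
  treeOf factorisationOfTree
  (λ {c} (s , f , b) →
     wellFormed-treeOf c , trans (edges-treeOf c) s ,
     trans (stemSize-treeOf c) b , trans (prefixEdges-treeOf c) f)
  (λ {t} (w , e , s , p) → statistics-of-treeOf (factorisationOfTree t)
     (treeOf-factorisationOfTree-wellFormed t w) e s p)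
  (λ {(P , bs)} _ → factorisationOfTree-tree P bs)
  (λ {t} (w , _) → treeOf-factorisationOfTree-wellFormed t w)
  where
  statistics-of-treeOf : ∀ c {t} → treeOf c ≡ t →
    edges t ≡ n → stemSize t ≡ k → prefixEdges t ≡ m →
    (size c ≡ n) × (flaws c ≡ m) × (blockCount c ≡ k)
  statistics-of-treeOf c refl e s p =
    trans (sym (edges-treeOf c)) e ,
    trans (sym (prefixEdges-treeOf c)) p ,
    trans (sym (stemSize-treeOf c)) s

theorem3p9 : (k m n : ℕ) → k ≤ m → m ≤ n →
    FreeSchroder n m k ⤖ LCDRTree n k m
theorem3p9 k m n _ _ =
  ↔⇒⤖ (↔-trans (freeSchroder↔factorisation n m k) (factorisation↔tree n m k))
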